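{- Let $G=(V,E)$ be a circle graph given by an interval representation as in the context, with $V=\{1,\dots,n\}$ ordered so that $I(i)\supseteq I(j)$ implies $i\le j$, and let $w:V\to\mathbb R$ be any vertex weight function (negative values allowed), extended by $w(0)=0$. Define $(\ell_i)_{i\in V\cup\{0\}}$ recursively for $i=n,n-1,\dots,1,0$ by \[ \ell_i=\begin{cases} w(i)+\max\Big\{\sum_{j\in V'}\ell_j : V'\subseteq V_i,\ V' \text{ a chain of }(V,\preceq)\Big\} & (i\in V^{\bullet}\cup\{0\}),\\ w(i) & (i\in V\setminus V^{\bullet}),\end{cases} \] where $V'=\emptyset$ is allowed. Then $\ell_0$ equals the maximum of $\sum_{i\in S}w(i)$ over all independent sets $S$ of $G$ (including $S=\emptyset$).
   Context: $V$ is finite; for each $j\in V$, $I(j)=[l_j,r_j]\subseteq\mathbb R$ with $l_j<r_j$, all $2|V|$ endpoints pairwise distinct; $G=(V,E)$ has $\{i,j\}\in E$ ($i\ne j$) iff $I(i)\cap I(j)\ne\emptyset$ and neither interval contains the other. Partial order: $i\preceq j$ iff $i=j$ or $r_i\le l_j$. With $0\notin V$ a root, the arc set is $A=\{(0,i):i\in V\}\cup\{(i,j):I(i)\supsetneq I(j)\}$; for $i\in V\cup\{0\}$, $V_i=\{j\in V:(i,j)\in A\}$ (so $V_0=V$, and $j\in V_i$ implies $j>i$, making the recursion well defined); $V^{\bullet}=\{i\in V:V_i\ne\emptyset\}$.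
   Formalization: The vertex weights $w$ and the interval endpoints $l_j,r_j$ are rational instead of real. -}

module Defs where

open import Data.Nat using (ℕ; zero; suc)
open import Data.Fin using (Fin; zero; suc)
import Data.Fin as F
open import Data.Fin.Subset using (Subset; _∈_; _⊆_)
open import Data.Vec using (lookup)
open import Data.Bool using (if_then_else_)
open import Data.Rational using (ℚ; 0ℚ; _+_; _≤_; _<_)
open import Data.Product using (Σ; ∃; _×_; _,_)
open import Data.Sum using (_⊎_)
open import Relation.Binary.PropositionalEquality using (_≡_; _≢_)
open import Relation.Nullary using (¬_)

-- Vertices V = {1,…,n} are represented by Fin n (paper vertex k ↔ index k-1,
-- same order).  The root 0 is treated separately.

sumFin : ∀ {n} → (Fin n → ℚ) → ℚ
sumFin {zero}  f = 0ℚ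
sumFin {suc n} f = f zero + sumFin (λ i → f (suc i))

subsetSum : ∀ {n} → (Fin n → ℚ) → Subset n → ℚ
subsetSum f S = sumFin (λ i → if lookup S i then f i else 0ℚ)

IsMax : ∀ {n} → (Subset n → Set) → (Subset n → ℚ) → ℚ → Set
IsMax {n} P val m = (Σ (Subset n) λ S → P S × val S ≡ m)
                  × (∀ S → P S → val S ≤ m)

module Intervals {n : ℕ} (l r : Fin n → ℚ) where

  Contains : Fin n → Fin n → Set
  Contains i j = l i ≤ l j × r j ≤ r i

  ProperContains : Fin n → Fin n → Set
  ProperContains i j = Contains i j × i ≢ j

  Intersect : Fin n → Fin n → Set
  Intersect i j = l i ≤ r j × l j ≤ r i

  Edge : Fin n → Fin n → Set
  Edge i j = i ≢ j × Intersect i j × ¬ Contains i j × ¬ Contains j i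

  Independent : Subset n → Set
  Independent S = ∀ i j → i ∈ S → j ∈ S → ¬ Edge i j

  Prec : Fin n → Fin n → Set
  Prec i j = i ≡ j ⊎ r i ≤ l j

  Chain : Subset n → Set
  Chain S = ∀ i j → i ∈ S → j ∈ S → Prec i j ⊎ Prec j i

  InVi : Fin n → Subset n → Set
  InVi i S = ∀ j → j ∈ S → ProperContains i j

  Bullet : Fin n → Set
  Bullet i = ∃ λ j → ProperContains i j

  -- (L, L0) satisfies the recursion defining ℓ (L i = ℓ_i, L0 = ℓ_0),
  -- with w(0) = 0 and V_0 = V.
  IsEll : (w : Fin n → ℚ) → (L : Fin n → ℚ) → ℚ → Set
  IsEll w L L0 =
      IsMax Chain (subsetSum L) L0
    × (∀ i → Bullet i →
         Σ ℚ λ m → IsMax (λ S → InVi i S × Chain S) (subsetSum L) m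
                  × L i ≡ w i + m)
    × (∀ i → ¬ Bullet i → L i ≡ w i)

  WellFormed : Set
  WellFormed = (∀ i → l i < r i)
             × (∀ i j → i ≢ j → l i ≢ l j)
             × (∀ i j → i ≢ j → r i ≢ r j)
             × (∀ i j → l i ≢ r j)
             × (∀ i j → Contains i j → i F.≤ j)

{-# OPTIONS --safe #-}

-- For i ∈ V let αBelow i be the largest weight of an independent set inside V_i, attained by T_i,
-- and put ℓ_i = w(i) + αBelow i.  If D is a set of vertices closed under proper containment, the
-- largest ℓ-weight of a chain in D equals the largest w-weight of an independent set in D.  A chain C
-- gives the independent set ⋃_{j ∈ C} ({j} ∪ T_j) of w-weight ℓ(C), because distinct members of a
-- chain are disjoint intervals.  Conversely the maximal intervals of an independent set S are pairwise
-- non-nested and non-crossing, hence form a chain C, and S splits into the blocks {j} ∪ (S ∩ V_j) for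
-- j ∈ C, each of weight at most ℓ_j.  With D = V_i this says that ℓ satisfies the recursion, with D = V
-- that ℓ_0 is the maximum weight of an independent set; and since V_i only contains vertices after i,
-- the recursion has no other solution.
module Submission where

open import Data.Bool using (true; false; if_then_else_)
open import Data.Empty using (⊥)
open import Data.Fin using (Fin; zero; suc; punchIn)
import Data.Fin as F
open import Data.Fin.Induction using (<-wellFounded; >-wellFounded)
import Data.Fin.Properties as FP
open import Data.Fin.Subset using (Subset; _∈_; _∉_; _∪_; ⁅_⁆) renaming (⊥ to ∅)
open import Data.Fin.Subset.Properties using (_∈?_; ∉⊥; x∈⁅x⁆; x∈⁅y⁆⇒x≡y; x≢y⇒x∉⁅y⁆; x∈p∪q⁺; x∈p∪q⁻)
open import Data.Nat using (ℕ; zero; suc)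
open import Data.Product using (Σ; ∃; _×_; _,_; proj₁; proj₂)
open import Data.Rational using (ℚ; 0ℚ; _+_; _≤_; _<_)
import Data.Rational.Properties as QP
open import Algebra.Properties.CommutativeMonoid.Sum QP.+-0-commutativeMonoid
  using (sum; sum-cong-≗; sum-replicate-zero; sum-remove; ∑-distrib-+; ∑-comm)
open import Data.Sum using (_⊎_; inj₁; inj₂; [_,_]′)
open import Data.Unit using (⊤; tt)
open import Data.Vec using ([]; _∷_; lookup; tabulate)
open import Data.Vec.Functional using (removeAt)
open import Data.Vec.Properties using ([]=⇒lookup; lookup⇒[]=; lookup∘tabulate)
open import Function using (_∘_)
open import Induction.WellFounded using (Acc; acc)
open import Relation.Binary.PropositionalEquality
open import Relation.Nullary using (¬_; Dec; yes; no; does; contradiction)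
open import Relation.Nullary.Decidable using (dec-true; _×-dec_; _→-dec_; ¬?)
open import Relation.Unary using (Decidable)

open import Defs

-- Sums over subsets

restrict : ∀ {n} → Subset n → (Fin n → ℚ) → Fin n → ℚ
restrict S f k = if lookup S k then f k else 0ℚ

module _ {n : ℕ} {S : Subset n} (f : Fin n → ℚ) {k : Fin n} where

  restrict-∈ : k ∈ S → restrict S f k ≡ f k
  restrict-∈ k∈S rewrite []=⇒lookup k∈S = refl

  restrict-∉ : k ∉ S → restrict S f k ≡ 0ℚ
  restrict-∉ k∉S with lookup S k in eq
  ... | true  = contradiction (lookup⇒[]= k S eq) k∉S
  ... | false = refl

sum-zero : ∀ {n} {f : Fin n → ℚ} → (∀ k → f k ≡ 0ℚ) → sum f ≡ 0ℚ
sum-zero {n} f≗0 = trans (sum-cong-≗ f≗0) (sum-replicate-zero n)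

sum-single : ∀ {n} (f : Fin n → ℚ) (j : Fin n) → (∀ k → k ≢ j → f k ≡ 0ℚ) → sum f ≡ f j
sum-single {suc n} f j others≡0 = begin
  sum f                   ≡⟨ sum-remove f ⟩
  f j + sum (removeAt f j) ≡⟨ cong (f j +_) (sum-zero (λ k → others≡0 (punchIn j k) (FP.punchInᵢ≢i j k))) ⟩
  f j + 0ℚ                ≡⟨ QP.+-identityʳ (f j) ⟩
  f j                     ∎
  where open ≡-Reasoning

sum-mono : ∀ {n} {f g : Fin n → ℚ} → (∀ k → f k ≤ g k) → sum f ≤ sum g
sum-mono {zero}  f≤g = QP.≤-refl
sum-mono {suc n} f≤g = QP.+-mono-≤ (f≤g zero) (sum-mono (f≤g ∘ suc))

sumFin≡sum : ∀ {n} (f : Fin n → ℚ) → sumFin f ≡ sum f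
sumFin≡sum {zero}  f = refl
sumFin≡sum {suc n} f = cong (f zero +_) (sumFin≡sum (f ∘ suc))

subsetSum≡sum : ∀ {n} (f : Fin n → ℚ) (S : Subset n) → subsetSum f S ≡ sum (restrict S f)
subsetSum≡sum f S = sumFin≡sum (restrict S f)

module _ {n : ℕ} where

  restrict-cong : ∀ {S : Subset n} {f g : Fin n → ℚ} → (∀ {k} → k ∈ S → f k ≡ g k) →
                  ∀ k → restrict S f k ≡ restrict S g k
  restrict-cong {S} {f} {g} f≡g k with k ∈? S
  ... | yes k∈S = trans (restrict-∈ f k∈S) (trans (f≡g k∈S) (sym (restrict-∈ g k∈S)))
  ... | no  k∉S = trans (restrict-∉ f k∉S) (sym (restrict-∉ g k∉S))

  subsetSum-cong : ∀ {f g : Fin n → ℚ} (S : Subset n) → (∀ {k} → k ∈ S → f k ≡ g k) →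
                   subsetSum f S ≡ subsetSum g S
  subsetSum-cong {f} {g} S f≡g = begin
    subsetSum f S        ≡⟨ subsetSum≡sum f S ⟩
    sum (restrict S f)   ≡⟨ sum-cong-≗ (restrict-cong f≡g) ⟩
    sum (restrict S g)   ≡⟨ subsetSum≡sum g S ⟨
    subsetSum g S        ∎
    where open ≡-Reasoning

  subsetSum-mono : ∀ {f g : Fin n → ℚ} (S : Subset n) → (∀ {k} → k ∈ S → f k ≤ g k) →
                   subsetSum f S ≤ subsetSum g S
  subsetSum-mono {f} {g} S f≤g =
    subst₂ _≤_ (sym (subsetSum≡sum f S)) (sym (subsetSum≡sum g S)) (sum-mono restrict-mono)
    where
    restrict-mono : ∀ k → restrict S f k ≤ restrict S g k
    restrict-mono k with k ∈? S
    ... | yes k∈S = subst₂ _≤_ (sym (restrict-∈ f k∈S)) (sym (restrict-∈ g k∈S)) (f≤g k∈S)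
    ... | no  k∉S = subst₂ _≤_ (sym (restrict-∉ f k∉S)) (sym (restrict-∉ g k∉S)) QP.≤-refl

  subsetSum-empty : ∀ (f : Fin n → ℚ) {S : Subset n} → (∀ k → k ∉ S) → subsetSum f S ≡ 0ℚ
  subsetSum-empty f {S} empty = trans (subsetSum≡sum f S) (sum-zero (λ k → restrict-∉ f (empty k)))

  subsetSum-⁅⁆ : ∀ (f : Fin n → ℚ) j → subsetSum f ⁅ j ⁆ ≡ f j
  subsetSum-⁅⁆ f j = begin
    subsetSum f ⁅ j ⁆        ≡⟨ subsetSum≡sum f ⁅ j ⁆ ⟩
    sum (restrict ⁅ j ⁆ f)   ≡⟨ sum-single _ j (λ k k≢j → restrict-∉ f (x≢y⇒x∉⁅y⁆ k≢j)) ⟩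
    restrict ⁅ j ⁆ f j       ≡⟨ restrict-∈ f (x∈⁅x⁆ j) ⟩
    f j                      ∎
    where open ≡-Reasoning

  subsetSum-∪ : ∀ (f : Fin n → ℚ) (S S′ : Subset n) → (∀ {k} → k ∈ S → k ∉ S′) →
                subsetSum f (S ∪ S′) ≡ subsetSum f S + subsetSum f S′
  subsetSum-∪ f S S′ disjoint = begin
    subsetSum f (S ∪ S′)                          ≡⟨ subsetSum≡sum f (S ∪ S′) ⟩
    sum (restrict (S ∪ S′) f)                     ≡⟨ sum-cong-≗ restrict-∪ ⟩
    sum (λ k → restrict S f k + restrict S′ f k)  ≡⟨ ∑-distrib-+ (restrict S f) (restrict S′ f) ⟩
    sum (restrict S f) + sum (restrict S′ f)      ≡⟨ cong₂ _+_ (subsetSum≡sum f S) (subsetSum≡sum f S′) ⟨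
    subsetSum f S + subsetSum f S′                ∎
    where
    open ≡-Reasoning
    restrict-∪ : ∀ k → restrict (S ∪ S′) f k ≡ restrict S f k + restrict S′ f k
    restrict-∪ k with k ∈? S | k ∈? S′
    ... | yes k∈S | yes k∈S′ = contradiction k∈S′ (disjoint k∈S)
    ... | yes k∈S | no  k∉S′ = begin
      restrict (S ∪ S′) f k  ≡⟨ restrict-∈ f (x∈p∪q⁺ (inj₁ k∈S)) ⟩
      f k                    ≡⟨ QP.+-identityʳ (f k) ⟨
      f k + 0ℚ               ≡⟨ cong₂ _+_ (restrict-∈ f k∈S) (restrict-∉ f k∉S′) ⟨
      restrict S f k + restrict S′ f k ∎
    ... | no  k∉S | yes k∈S′ = begin
      restrict (S ∪ S′) f k  ≡⟨ restrict-∈ f (x∈p∪q⁺ {p = S} (inj₂ k∈S′)) ⟩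
      f k                    ≡⟨ QP.+-identityˡ (f k) ⟨
      0ℚ + f k               ≡⟨ cong₂ _+_ (restrict-∉ f k∉S) (restrict-∈ f k∈S′) ⟨
      restrict S f k + restrict S′ f k ∎
    ... | no  k∉S | no  k∉S′ = begin
      restrict (S ∪ S′) f k  ≡⟨ restrict-∉ f ([ k∉S , k∉S′ ]′ ∘ x∈p∪q⁻ S S′) ⟩
      0ℚ                     ≡⟨ QP.+-identityʳ 0ℚ ⟨
      0ℚ + 0ℚ                ≡⟨ cong₂ _+_ (restrict-∉ f k∉S) (restrict-∉ f k∉S′) ⟨
      restrict S f k + restrict S′ f k ∎

subsetSum-partition : ∀ {m n} (f : Fin n → ℚ) (C : Subset m) (B : Fin m → Subset n) (S : Subset n) →
  (∀ {k} → k ∈ S → ∃ λ j → j ∈ C × k ∈ B j) →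
  (∀ {j k} → j ∈ C → k ∈ B j → k ∈ S) →
  (∀ {j j′ k} → j ∈ C → j′ ∈ C → k ∈ B j → k ∈ B j′ → j ≡ j′) →
  subsetSum f S ≡ subsetSum (λ j → subsetSum f (B j)) C
subsetSum-partition {m} {n} f C B S cover inside unique = begin
  subsetSum f S                                 ≡⟨ subsetSum≡sum f S ⟩
  sum (restrict S f)                            ≡⟨ sum-cong-≗ fibre ⟨
  sum (λ k → sum (λ j → t j k))                 ≡⟨ ∑-comm t ⟨
  sum (λ j → sum (t j))                         ≡⟨ sum-cong-≗ block ⟩
  sum (restrict C (λ j → subsetSum f (B j)))    ≡⟨ subsetSum≡sum _ C ⟨
  subsetSum (λ j → subsetSum f (B j)) C         ∎
  where
  open ≡-Reasoning
  t : Fin m → Fin n → ℚ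
  t j k = restrict C (λ j → restrict (B j) f k) j

  t-∈ : ∀ {j k} → j ∈ C → k ∈ B j → t j k ≡ f k
  t-∈ {j} {k} j∈C k∈Bj = trans (restrict-∈ (λ j → restrict (B j) f k) j∈C) (restrict-∈ f k∈Bj)

  t-∉ : ∀ {j k} → ¬ (j ∈ C × k ∈ B j) → t j k ≡ 0ℚ
  t-∉ {j} {k} outside with j ∈? C
  ... | yes j∈C = trans (restrict-∈ (λ j → restrict (B j) f k) j∈C)
                        (restrict-∉ f (λ k∈Bj → outside (j∈C , k∈Bj)))
  ... | no  j∉C = restrict-∉ (λ j → restrict (B j) f k) j∉C

  block : ∀ j → sum (t j) ≡ restrict C (λ j → subsetSum f (B j)) j
  block j with j ∈? C
  ... | yes j∈C = begin
    sum (t j)                ≡⟨ sum-cong-≗ (λ k → restrict-∈ (λ j → restrict (B j) f k) j∈C) ⟩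
    sum (restrict (B j) f)   ≡⟨ subsetSum≡sum f (B j) ⟨
    subsetSum f (B j)        ≡⟨ restrict-∈ (λ j → subsetSum f (B j)) j∈C ⟨
    restrict C (λ j → subsetSum f (B j)) j ∎
  ... | no  j∉C = trans (sum-zero (λ k → t-∉ {j} {k} (j∉C ∘ proj₁)))
                        (sym (restrict-∉ (λ j → subsetSum f (B j)) j∉C))

  fibre : ∀ k → sum (λ j → t j k) ≡ restrict S f k
  fibre k with k ∈? S
  ... | yes k∈S = let (j , j∈C , k∈Bj) = cover k∈S in begin
    sum (λ j → t j k)  ≡⟨ sum-single (λ j → t j k) j
                            (λ j′ j′≢j → t-∉ {j′} {k} (λ (j′∈C , k∈Bj′) → j′≢j (unique j′∈C j∈C k∈Bj′ k∈Bj))) ⟩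
    t j k              ≡⟨ t-∈ j∈C k∈Bj ⟩
    f k                ≡⟨ restrict-∈ f k∈S ⟨
    restrict S f k     ∎
  ... | no  k∉S = trans (sum-zero (λ j → t-∉ {j} {k} (λ (j∈C , k∈Bj) → k∉S (inside j∈C k∈Bj))))
                        (sym (restrict-∉ f k∉S))

-- Maxima over subsets

subsetOf : ∀ {n} {P : Fin n → Set} → Decidable P → Subset n
subsetOf P? = tabulate (does ∘ P?)

module _ {n : ℕ} {P : Fin n → Set} (P? : Decidable P) {k : Fin n} where

  lookup-subsetOf : lookup (subsetOf P?) k ≡ does (P? k)
  lookup-subsetOf = lookup∘tabulate (does ∘ P?) k

  ∈-subsetOf⁺ : P k → k ∈ subsetOf P?
  ∈-subsetOf⁺ p = lookup⇒[]= k _ (trans lookup-subsetOf (dec-true (P? k) p))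

  ∈-subsetOf⁻ : k ∈ subsetOf P? → P k
  ∈-subsetOf⁻ k∈ with P? k | trans (sym lookup-subsetOf) ([]=⇒lookup k∈)
  ... | yes p | _ = p

module _ {n : ℕ} {P : Subset n → Set} {v : Subset n → ℚ} where

  IsMax-unique : ∀ {m m′} → IsMax P v m → IsMax P v m′ → m ≡ m′
  IsMax-unique ((S , PS , vS≡m) , ≤m) ((S′ , PS′ , vS′≡m′) , ≤m′) =
    QP.≤-antisym (subst (_≤ _) vS≡m (≤m′ S PS)) (subst (_≤ _) vS′≡m′ (≤m S′ PS′))

  IsMax-≗ : ∀ {v′ m} → (∀ S → P S → v S ≡ v′ S) → IsMax P v m → IsMax P v′ m
  IsMax-≗ {m = m} v≡v′ ((S , PS , vS≡m) , ≤m) =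
    (S , PS , trans (sym (v≡v′ S PS)) vS≡m) , λ S′ PS′ → subst (_≤ m) (v≡v′ S′ PS′) (≤m S′ PS′)

  IsMax-⇔ : ∀ {Q m} → (∀ S → P S → Q S) → (∀ S → Q S → P S) → IsMax P v m → IsMax Q v m
  IsMax-⇔ P⇒Q Q⇒P ((S , PS , vS≡m) , ≤m) = (S , P⇒Q S PS , vS≡m) , λ S′ QS′ → ≤m S′ (Q⇒P S′ QS′)

max-or-empty : ∀ {n} {P : Subset n → Set} → Decidable P → (v : Subset n → ℚ) →
               (∀ S → ¬ P S) ⊎ ∃ (IsMax P v)
max-or-empty {zero} P? v with P? []
... | yes p = inj₂ (v [] , ([] , p , refl) , λ { [] _ → QP.≤-refl })
... | no ¬p = inj₁ λ { [] → ¬p }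
max-or-empty {suc n} P? v
  with max-or-empty (P? ∘ (false ∷_)) (v ∘ (false ∷_)) | max-or-empty (P? ∘ (true ∷_)) (v ∘ (true ∷_))
... | inj₁ ¬P₀ | inj₁ ¬P₁ = inj₁ λ { (false ∷ S) → ¬P₀ S ; (true ∷ S) → ¬P₁ S }
... | inj₁ ¬P₀ | inj₂ (m₁ , (S₁ , p₁ , e₁) , ≤m₁) =
  inj₂ (m₁ , (true ∷ S₁ , p₁ , e₁) , λ { (false ∷ S) p → contradiction p (¬P₀ S) ; (true ∷ S) p → ≤m₁ S p })
... | inj₂ (m₀ , (S₀ , p₀ , e₀) , ≤m₀) | inj₁ ¬P₁ =
  inj₂ (m₀ , (false ∷ S₀ , p₀ , e₀) , λ { (false ∷ S) p → ≤m₀ S p ; (true ∷ S) p → contradiction p (¬P₁ S) })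
... | inj₂ (m₀ , (S₀ , p₀ , e₀) , ≤m₀) | inj₂ (m₁ , (S₁ , p₁ , e₁) , ≤m₁) with QP.≤-total m₀ m₁
...   | inj₁ m₀≤m₁ = inj₂ (m₁ , (true ∷ S₁ , p₁ , e₁) ,
                       λ { (false ∷ S) p → QP.≤-trans (≤m₀ S p) m₀≤m₁ ; (true ∷ S) p → ≤m₁ S p })
...   | inj₂ m₁≤m₀ = inj₂ (m₀ , (false ∷ S₀ , p₀ , e₀) ,
                       λ { (false ∷ S) p → ≤m₀ S p ; (true ∷ S) p → QP.≤-trans (≤m₁ S p) m₁≤m₀ })

max-exists : ∀ {n} {P : Subset n → Set} → Decidable P → ∀ {S} → P S → (v : Subset n → ℚ) → ∃ (IsMax P v)
max-exists P? {S} PS v with max-or-empty P? v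
... | inj₁ ¬P = contradiction PS (¬P S)
... | inj₂ max = max

-- InVi i is Within (ProperContains i) definitionally, and D = λ _ → ⊤ stands for the root.
Within : ∀ {n} → (Fin n → Set) → Subset n → Set
Within D S = ∀ j → j ∈ S → D j

Within? : ∀ {n} {D : Fin n → Set} → Decidable D → Decidable (Within D)
Within? D? S = FP.all? (λ j → (j ∈? S) →-dec D? j)

-- Interval geometry

module CircleGraph {n : ℕ} (l r : Fin n → ℚ) (wf : Intervals.WellFormed l r) where
  open Intervals l r

  private
    l<r : ∀ i → l i < r i
    l<r = proj₁ wf

    l≢r : ∀ i j → l i ≢ r j
    l≢r = proj₁ (proj₂ (proj₂ (proj₂ wf)))

    Contains⇒≤ : ∀ i j → Contains i j → i F.≤ j
    Contains⇒≤ = proj₂ (proj₂ (proj₂ (proj₂ wf)))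

  Contains? : ∀ i j → Dec (Contains i j)
  Contains? i j = (l i QP.≤? l j) ×-dec (r j QP.≤? r i)

  ProperContains? : ∀ i j → Dec (ProperContains i j)
  ProperContains? i j = Contains? i j ×-dec ¬? (i FP.≟ j)

  Edge? : ∀ i j → Dec (Edge i j)
  Edge? i j = ¬? (i FP.≟ j) ×-dec ((l i QP.≤? r j) ×-dec (l j QP.≤? r i))
              ×-dec ¬? (Contains? i j) ×-dec ¬? (Contains? j i)

  Independent? : Decidable Independent
  Independent? S = FP.all? λ i → FP.all? λ j → (i ∈? S) →-dec (j ∈? S) →-dec ¬? (Edge? i j)

  ∅-independent : Independent ∅
  ∅-independent i j i∈∅ = contradiction i∈∅ ∉⊥

  Independent-⊆ : ∀ {S S′} → (∀ {k} → k ∈ S′ → k ∈ S) → Independent S → Independent S′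
  Independent-⊆ S′⊆S indS i j i∈S′ j∈S′ = indS i j (S′⊆S i∈S′) (S′⊆S j∈S′)

  Contains-refl : ∀ i → Contains i i
  Contains-refl i = QP.≤-refl , QP.≤-refl

  Contains-trans : ∀ {i j k} → Contains i j → Contains j k → Contains i k
  Contains-trans (li≤lj , rj≤ri) (lj≤lk , rk≤rj) = QP.≤-trans li≤lj lj≤lk , QP.≤-trans rk≤rj rj≤ri

  ProperContains⇒< : ∀ {i j} → ProperContains i j → i F.< j
  ProperContains⇒< {i} {j} (i⊇j , i≢j) = FP.≤∧≢⇒< (Contains⇒≤ i j i⊇j) i≢j

  ProperContains-trans : ∀ {i j k} → ProperContains i j → ProperContains j k → ProperContains i k
  ProperContains-trans i⊃j j⊃k =
    Contains-trans (proj₁ i⊃j) (proj₁ j⊃k) ,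
    FP.<⇒≢ (FP.<-trans (ProperContains⇒< i⊃j) (ProperContains⇒< j⊃k))

  Separated : Fin n → Fin n → Set
  Separated i j = r i ≤ l j ⊎ r j ≤ l i

  Chain⇒Separated : ∀ {C} → Chain C → ∀ {i j} → i ∈ C → j ∈ C → i ≢ j → Separated i j
  Chain⇒Separated chC {i} {j} i∈C j∈C i≢j with chC i j i∈C j∈C
  ... | inj₁ (inj₁ i≡j) = contradiction i≡j i≢j
  ... | inj₁ (inj₂ ri≤lj) = inj₁ ri≤lj
  ... | inj₂ (inj₁ j≡i) = contradiction (sym j≡i) i≢j
  ... | inj₂ (inj₂ rj≤li) = inj₂ rj≤li

  ¬Intersect⇒Separated : ∀ {i j} → ¬ Intersect i j → Separated i j
  ¬Intersect⇒Separated {i} {j} ¬i∩j with l i QP.≤? r j | l j QP.≤? r i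
  ... | yes li≤rj | yes lj≤ri = contradiction (li≤rj , lj≤ri) ¬i∩j
  ... | yes _     | no  lj≰ri = inj₁ (QP.<⇒≤ (QP.≰⇒> lj≰ri))
  ... | no  li≰rj | _         = inj₂ (QP.<⇒≤ (QP.≰⇒> li≰rj))

  -- Separation allows r i = l j; the distinctness of endpoints is what rules out intersection.
  Separated⇒¬Intersect : ∀ {i j a b} → Separated i j → Contains i a → Contains j b → ¬ Intersect a b
  Separated⇒¬Intersect {i} {j} {a} {b} (inj₁ ri≤lj) (_ , ra≤ri) (lj≤lb , _) (_ , lb≤ra) =
    l≢r b a (QP.≤-antisym lb≤ra (QP.≤-trans ra≤ri (QP.≤-trans ri≤lj lj≤lb)))
  Separated⇒¬Intersect {i} {j} {a} {b} (inj₂ rj≤li) (li≤la , _) (_ , rb≤rj) (la≤rb , _) =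
    l≢r a b (QP.≤-antisym la≤rb (QP.≤-trans rb≤rj (QP.≤-trans rj≤li li≤la)))

  Separated⇒¬Contains-common : ∀ {i j k} → Separated i j → Contains i k → Contains j k → ⊥
  Separated⇒¬Contains-common {k = k} sep i⊇k j⊇k =
    Separated⇒¬Intersect sep i⊇k j⊇k (QP.<⇒≤ (l<r k) , QP.<⇒≤ (l<r k))

  nestingFree-independent⇒Chain : ∀ {S} → Independent S →
    (∀ {i j} → i ∈ S → j ∈ S → i ≢ j → ¬ Contains i j) → Chain S
  nestingFree-independent⇒Chain indS nestingFree i j i∈S j∈S with i FP.≟ j
  ... | yes i≡j = inj₁ (inj₁ i≡j)
  ... | no  i≢j with ¬Intersect⇒Separated (λ i∩j →
          indS i j i∈S j∈S (i≢j , i∩j , nestingFree i∈S j∈S i≢j , nestingFree j∈S i∈S (i≢j ∘ sym)))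
  ...   | inj₁ ri≤lj = inj₁ (inj₂ ri≤lj)
  ...   | inj₂ rj≤li = inj₂ (inj₂ rj≤li)

  block⇒Contains : ∀ {j k X} → InVi j X → k ∈ ⁅ j ⁆ ∪ X → Contains j k
  block⇒Contains {j} {k} {X} X⊆Vj k∈B with x∈p∪q⁻ ⁅ j ⁆ X k∈B
  ... | inj₁ k∈⁅j⁆ rewrite x∈⁅y⁆⇒x≡y j k∈⁅j⁆ = Contains-refl j
  ... | inj₂ k∈X = proj₁ (X⊆Vj k k∈X)

  subsetSum-chainBlocks : ∀ (f : Fin n → ℚ) {S C : Subset n} (X : Fin n → Subset n) →
    Chain C → (∀ j → InVi j (X j)) →
    (∀ {k} → k ∈ S → ∃ λ j → j ∈ C × k ∈ ⁅ j ⁆ ∪ X j) →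
    (∀ {j k} → j ∈ C → k ∈ ⁅ j ⁆ ∪ X j → k ∈ S) →
    subsetSum f S ≡ subsetSum (λ j → f j + subsetSum f (X j)) C
  subsetSum-chainBlocks f {S} {C} X chC X⊆V cover inside =
    trans (subsetSum-partition f C (λ j → ⁅ j ⁆ ∪ X j) S cover inside unique) (subsetSum-cong C block-sum)
    where
    unique : ∀ {j j′ k} → j ∈ C → j′ ∈ C → k ∈ ⁅ j ⁆ ∪ X j → k ∈ ⁅ j′ ⁆ ∪ X j′ → j ≡ j′
    unique {j} {j′} j∈C j′∈C k∈Bj k∈Bj′ with j FP.≟ j′
    ... | yes j≡j′ = j≡j′
    ... | no  j≢j′ = contradiction (block⇒Contains (X⊆V j′) k∈Bj′)
                       (Separated⇒¬Contains-common (Chain⇒Separated chC j∈C j′∈C j≢j′)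
                                                    (block⇒Contains (X⊆V j) k∈Bj))
    block-sum : ∀ {j} → j ∈ C → subsetSum f (⁅ j ⁆ ∪ X j) ≡ f j + subsetSum f (X j)
    block-sum {j} _ = trans (subsetSum-∪ f ⁅ j ⁆ (X j) j∉Xj) (cong (_+ subsetSum f (X j)) (subsetSum-⁅⁆ f j))
      where
      j∉Xj : ∀ {k} → k ∈ ⁅ j ⁆ → k ∉ X j
      j∉Xj k∈⁅j⁆ k∈Xj rewrite x∈⁅y⁆⇒x≡y j k∈⁅j⁆ = proj₂ (X⊆V j j k∈Xj) refl

  Maximal : Subset n → Fin n → Set
  Maximal S k = k ∈ S × ¬ (∃ λ j → j ∈ S × ProperContains j k)

  Maximal? : ∀ S → Decidable (Maximal S)
  Maximal? S k = (k ∈? S) ×-dec ¬? (FP.any? λ j → (j ∈? S) ×-dec ProperContains? j k)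

  maximal-above : ∀ {S k} → k ∈ S → ∃ λ j → Maximal S j × Contains j k
  maximal-above {S} {k} k∈S = go k∈S (<-wellFounded k)
    where
    go : ∀ {k} → k ∈ S → Acc F._<_ k → ∃ λ j → Maximal S j × Contains j k
    go {k} k∈S (acc smaller) with FP.any? (λ j → (j ∈? S) ×-dec ProperContains? j k)
    ... | no  ¬above = k , (k∈S , ¬above) , Contains-refl k
    ... | yes (j , j∈S , j⊃k) with go j∈S (smaller (ProperContains⇒< j⊃k))
    ...   | i , i-max , i⊇j = i , i-max , Contains-trans i⊇j (proj₁ j⊃k)

  -- The weights ℓ

  module Weighted (w : Fin n → ℚ) where

    -- Abstract, so that conversion checking never unfolds the search through all subsets.
    abstract
      maxIndependentBelow : ∀ i → ∃ (IsMax (λ S → Independent S × InVi i S) (subsetSum w))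
      maxIndependentBelow i =
        max-exists (λ S → Independent? S ×-dec Within? (ProperContains? i) S)
                   (∅-independent , λ _ j∈∅ → contradiction j∈∅ ∉⊥) (subsetSum w)

    αBelow : Fin n → ℚ
    αBelow i = proj₁ (maxIndependentBelow i)

    αBelow-isMax : ∀ i → IsMax (λ S → Independent S × InVi i S) (subsetSum w) (αBelow i)
    αBelow-isMax i = proj₂ (maxIndependentBelow i)

    ℓ : Fin n → ℚ
    ℓ i = w i + αBelow i

    independent⇒chain : ∀ {D : Fin n → Set} {S} → Independent S → Within D S →
      ∃ λ C → (Within D C × Chain C) × subsetSum w S ≤ subsetSum ℓ C
    independent⇒chain {D} {S} indS S⊆D = C , (C⊆D , C-chain) , wS≤ℓC
      where
      C : Subset n
      C = subsetOf (Maximal? S)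

      C⊆S : ∀ {k} → k ∈ C → k ∈ S
      C⊆S k∈C = proj₁ (∈-subsetOf⁻ (Maximal? S) k∈C)

      C⊆D : Within D C
      C⊆D k k∈C = S⊆D k (C⊆S k∈C)

      C-chain : Chain C
      C-chain = nestingFree-independent⇒Chain (Independent-⊆ C⊆S indS)
        λ i∈C j∈C i≢j i⊇j → proj₂ (∈-subsetOf⁻ (Maximal? S) j∈C) (_ , C⊆S i∈C , i⊇j , i≢j)

      Below? : ∀ j → Decidable (λ k → k ∈ S × ProperContains j k)
      Below? j k = (k ∈? S) ×-dec ProperContains? j k

      below : Fin n → Subset n
      below j = subsetOf (Below? j)

      below⊆V : ∀ j → InVi j (below j)
      below⊆V j k k∈below = proj₂ (∈-subsetOf⁻ (Below? j) k∈below)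

      cover : ∀ {k} → k ∈ S → ∃ λ j → j ∈ C × k ∈ ⁅ j ⁆ ∪ below j
      cover {k} k∈S with maximal-above k∈S
      ... | j , j-max , j⊇k with j FP.≟ k
      ...   | yes refl = j , ∈-subsetOf⁺ (Maximal? S) j-max , x∈p∪q⁺ (inj₁ (x∈⁅x⁆ j))
      ...   | no  j≢k  = j , ∈-subsetOf⁺ (Maximal? S) j-max ,
                         x∈p∪q⁺ {p = ⁅ j ⁆} (inj₂ (∈-subsetOf⁺ (Below? j) (k∈S , j⊇k , j≢k)))

      inside : ∀ {j k} → j ∈ C → k ∈ ⁅ j ⁆ ∪ below j → k ∈ S
      inside {j} j∈C k∈Bj with x∈p∪q⁻ ⁅ j ⁆ (below j) k∈Bj
      ... | inj₁ k∈⁅j⁆ rewrite x∈⁅y⁆⇒x≡y j k∈⁅j⁆ = C⊆S j∈C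
      ... | inj₂ k∈below = proj₁ (∈-subsetOf⁻ (Below? j) k∈below)

      below≤αBelow : ∀ j → subsetSum w (below j) ≤ αBelow j
      below≤αBelow j = proj₂ (αBelow-isMax j) (below j)
        (Independent-⊆ (proj₁ ∘ ∈-subsetOf⁻ (Below? j)) indS , below⊆V j)

      wS≤ℓC : subsetSum w S ≤ subsetSum ℓ C
      wS≤ℓC = subst (_≤ subsetSum ℓ C) (sym (subsetSum-chainBlocks w below C-chain below⊆V cover inside))
                (subsetSum-mono C (λ {j} _ → QP.+-monoʳ-≤ (w j) (below≤αBelow j)))

    module _ {D : Fin n → Set} (D-closed : ∀ {j k} → D j → ProperContains j k → D k) where

      chain⇒independent : ∀ {C} → Within D C → Chain C →
        ∃ λ U → (Independent U × Within D U) × subsetSum w U ≡ subsetSum ℓ C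
      chain⇒independent {C} C⊆D chC = U , (U-independent , U⊆D) , wU≡ℓC
        where
        T : Fin n → Subset n
        T j = proj₁ (proj₁ (αBelow-isMax j))

        T-independent : ∀ j → Independent (T j)
        T-independent j = proj₁ (proj₁ (proj₂ (proj₁ (αBelow-isMax j))))

        T⊆V : ∀ j → InVi j (T j)
        T⊆V j = proj₂ (proj₁ (proj₂ (proj₁ (αBelow-isMax j))))

        InBlock : Fin n → Set
        InBlock k = ∃ λ j → j ∈ C × k ∈ ⁅ j ⁆ ∪ T j

        InBlock? : Decidable InBlock
        InBlock? k = FP.any? λ j → (j ∈? C) ×-dec (k ∈? ⁅ j ⁆ ∪ T j)

        U : Subset n
        U = subsetOf InBlock?

        U⊆D : Within D U
        U⊆D k k∈U with ∈-subsetOf⁻ InBlock? k∈U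
        ... | j , j∈C , k∈Bj with x∈p∪q⁻ ⁅ j ⁆ (T j) k∈Bj
        ...   | inj₁ k∈⁅j⁆ rewrite x∈⁅y⁆⇒x≡y j k∈⁅j⁆ = C⊆D j j∈C
        ...   | inj₂ k∈Tj = D-closed (C⊆D j j∈C) (T⊆V j k k∈Tj)

        U-independent : Independent U
        U-independent a b a∈U b∈U edge with ∈-subsetOf⁻ InBlock? a∈U | ∈-subsetOf⁻ InBlock? b∈U
        ... | j , j∈C , a∈Bj | j′ , j′∈C , b∈Bj′ with j FP.≟ j′
        ...   | no j≢j′ = Separated⇒¬Intersect (Chain⇒Separated chC j∈C j′∈C j≢j′)
                            (block⇒Contains (T⊆V j) a∈Bj) (block⇒Contains (T⊆V j′) b∈Bj′) (proj₁ (proj₂ edge))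
        ...   | yes refl with x∈p∪q⁻ ⁅ j ⁆ (T j) a∈Bj | x∈p∪q⁻ ⁅ j ⁆ (T j) b∈Bj′
        ...     | inj₁ a∈⁅j⁆ | _ rewrite x∈⁅y⁆⇒x≡y j a∈⁅j⁆ =
                    proj₁ (proj₂ (proj₂ edge)) (block⇒Contains (T⊆V j) b∈Bj′)
        ...     | inj₂ _ | inj₁ b∈⁅j⁆ rewrite x∈⁅y⁆⇒x≡y j b∈⁅j⁆ =
                    proj₂ (proj₂ (proj₂ edge)) (block⇒Contains (T⊆V j) a∈Bj)
        ...     | inj₂ a∈Tj | inj₂ b∈Tj = T-independent j a b a∈Tj b∈Tj edge

        wU≡ℓC : subsetSum w U ≡ subsetSum ℓ C
        wU≡ℓC = trans
          (subsetSum-chainBlocks w T chC T⊆V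
            (λ k∈U → ∈-subsetOf⁻ InBlock? k∈U) (λ j∈C k∈Bj → ∈-subsetOf⁺ InBlock? (_ , j∈C , k∈Bj)))
          (subsetSum-cong C (λ {j} _ → cong (w j +_) (proj₂ (proj₂ (proj₁ (αBelow-isMax j))))))

      independentMax⇒chainMax : ∀ {m} → IsMax (λ S → Independent S × Within D S) (subsetSum w) m →
                 IsMax (λ C → Within D C × Chain C) (subsetSum ℓ) m
      independentMax⇒chainMax {m} ((S , (indS , S⊆D) , wS≡m) , ≤m) with independent⇒chain indS S⊆D
      ... | C , C-ok , wS≤ℓC = (C , C-ok , QP.≤-antisym (≤m′ C C-ok) (subst (_≤ _) wS≡m wS≤ℓC)) , ≤m′
        where
        ≤m′ : ∀ C → Within D C × Chain C → subsetSum ℓ C ≤ m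
        ≤m′ C (C⊆D , chC) with chain⇒independent C⊆D chC
        ... | U , U-ok , wU≡ℓC = subst (_≤ m) wU≡ℓC (≤m U U-ok)

    ℓ-bullet : ∀ i → IsMax (λ S → InVi i S × Chain S) (subsetSum ℓ) (αBelow i)
    ℓ-bullet i = independentMax⇒chainMax (ProperContains-trans {i}) (αBelow-isMax i)

    ℓ-leaf : ∀ i → ¬ Bullet i → ℓ i ≡ w i
    ℓ-leaf i leaf with αBelow-isMax i
    ... | (T , (_ , T⊆Vi) , wT≡α) , _ = begin
      w i + αBelow i        ≡⟨ cong (w i +_) wT≡α ⟨
      w i + subsetSum w T   ≡⟨ cong (w i +_) (subsetSum-empty w λ k k∈T → leaf (k , T⊆Vi k k∈T)) ⟩
      w i + 0ℚ              ≡⟨ QP.+-identityʳ (w i) ⟩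
      w i                   ∎
      where open ≡-Reasoning

    abstract
      maxIndependent : ∃ (IsMax Independent (subsetSum w))
      maxIndependent = max-exists Independent? ∅-independent (subsetSum w)

    α : ℚ
    α = proj₁ maxIndependent

    α-isMax : IsMax Independent (subsetSum w) α
    α-isMax = proj₂ maxIndependent

    ℓ-root : IsMax Chain (subsetSum ℓ) α
    ℓ-root = IsMax-⇔ (λ _ → proj₂) (λ _ chC → (λ _ _ → tt) , chC)
               (independentMax⇒chainMax {D = λ _ → ⊤} (λ _ _ → tt)
                 (IsMax-⇔ (λ _ indS → indS , λ _ _ → tt) (λ _ → proj₁) α-isMax))

    ℓ-isEll : IsEll w ℓ α
    ℓ-isEll = ℓ-root , (λ i _ → αBelow i , ℓ-bullet i , refl) , ℓ-leaf

    IsEll⇒≗ℓ : ∀ {L L0} → IsEll w L L0 → ∀ i → L i ≡ ℓ i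
    IsEll⇒≗ℓ {L} (_ , L-bullet , L-leaf) i = go i (>-wellFounded i)
      where
      go : ∀ i → Acc F._>_ i → L i ≡ ℓ i
      go i (acc larger) with FP.any? (ProperContains? i)
      ... | no  leaf = trans (L-leaf i leaf) (sym (ℓ-leaf i leaf))
      ... | yes bullet with L-bullet i bullet
      ...   | m , m-isMax , Li≡ = trans Li≡ (cong (w i +_) (IsMax-unique (IsMax-≗ L≡ℓ m-isMax) (ℓ-bullet i)))
        where
        L≡ℓ : ∀ S → InVi i S × Chain S → subsetSum L S ≡ subsetSum ℓ S
        L≡ℓ S (S⊆Vi , _) = subsetSum-cong S λ {k} k∈S → go k (larger (ProperContains⇒< (S⊆Vi k k∈S)))

    IsEll⇒root≡α : ∀ {L L0} → IsEll w L L0 → L0 ≡ α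
    IsEll⇒root≡α isEll@(L-root , _) =
      IsMax-unique (IsMax-≗ (λ S _ → subsetSum-cong S λ {k} _ → IsEll⇒≗ℓ isEll k) L-root) ℓ-root

mainTheorem6 : (n : ℕ) (l r w : Fin n → ℚ)
    → Intervals.WellFormed l r
    → (Σ (Fin n → ℚ) λ L → Σ ℚ λ L0 → Intervals.IsEll l r w L L0)
    × (∀ L L0 → Intervals.IsEll l r w L L0
    → IsMax (Intervals.Independent l r) (subsetSum w) L0)
mainTheorem6 n l r w wf = (ℓ , α , ℓ-isEll) , root-isMax
  where
  open CircleGraph.Weighted l r wf w

  root-isMax : ∀ L L0 → Intervals.IsEll l r w L L0 → IsMax (Intervals.Independent l r) (subsetSum w) L0
  root-isMax L L0 isEll =
    subst (IsMax (Intervals.Independent l r) (subsetSum w)) (sym (IsEll⇒root≡α isEll)) α-isMax
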